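{- $\mathsf V$, with the unit and flattening described below, satisfies the axioms of a monad on the category of ranked sets with positive arities: $\mathsf V$ is a functor; unit and flattening are natural; $\mathrm{flatten}_\Sigma\circ\mathrm{flatten}_{\mathsf V\Sigma}=\mathrm{flatten}_\Sigma\circ\mathsf V\,\mathrm{flatten}_\Sigma$; and $\mathrm{flatten}_\Sigma\circ\mathrm{unit}_{\mathsf V\Sigma}=\mathrm{flatten}_\Sigma\circ\mathsf V\,\mathrm{unit}_\Sigma=\mathrm{id}_{\mathsf V\Sigma}$.
   Context: Here a ranked set is a set whose elements have arities in $\{1,2,\dots\}$; morphisms are arity-preserving functions. A corner of a ranked set is a pair written $v[i]$ with $v$ an element and $1\le i\le$ arity of $v$. A $\mathsf V$-hypergraph over ranked set $\Sigma$ consists of a nonempty ranked set of hypervertices, an arity-preserving labelling of hypervertices by $\Sigma$, and a binary (directed) edge relation on the corners of the hypervertices. An $n$-ary $\mathsf V$-hypergraph with ports ($n\ge1$) additionally has a (not necessarily surjective) port function from corners to $\{1..n\}$; corners with value $j$ are $j$-ports. $\mathsf V\Sigma$: ranked set of finite $\mathsf V$-hypergraphs with ports over $\Sigma$ modulo isomorphism. $\mathsf Vf$ relabels. $\mathrm{unit}(a)$ for $n$-ary $a$: one $n$-ary hypervertex $v$ labelled $a$, no edges, port function $v[i]\mapsto i$. Flattening of $G\in\mathsf{VV}\Sigma$: hypervertices are pairs $(v,w)$ with $v$ a hypervertex of $G$ and $w$ a hypervertex in the label of $v$ (arity and label from $w$); the arity is that of $G$; if $w[i]$ is a $j$-port in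 the label of $v$ and $v[j]$ is a $k$-port of $G$ then $(v,w)[i]$ is a $k$-port; there is an edge $(v,w)[i]\to(v',w')[i']$ iff either $v=v'$ and $w[i]\to w'[i']$ in the label of $v$, or $v[j]\to v'[j']$ in $G$, where $j$ is the port number of $w[i]$ in the label of $v$ and $j'$ that of $w'[i']$ in the label of $v'$. -}

module Defs where

open import Data.Nat using (ℕ; zero; suc; _+_; _≤_)
open import Data.Nat.Properties using (≤-trans; m≤m+n)
open import Data.Fin using (Fin; zero; suc; toℕ; cast; splitAt; _≟_)
open import Data.Bool using (Bool; false; _∨_; _∧_)
open import Data.Sum using (inj₁; inj₂)
open import Data.Product using (Σ; _,_; proj₁; proj₂)
open import Relation.Nullary using (yes; no)
open import Relation.Binary.PropositionalEquality using (_≡_; refl; sym; trans; cong)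
open import Function.Bundles using (_↔_; Inverse)

record RankedSet : Set₁ where
  field
    Car    : Set
    ar     : Car → ℕ
    ar-pos : ∀ x → 1 ≤ ar x

-- A ranked set together with a relation on it (used to model a ranked
-- set given as a quotient, e.g. V Σ = hypergraphs modulo isomorphism).
record RSet : Set₁ where
  field
    Car     : Set
    _≈_     : Car → Car → Set
    ar      : Car → ℕ
    ar-pos  : ∀ x → 1 ≤ ar x
    ar-resp : ∀ {x y} → x ≈ y → ar x ≡ ar y

open RSet public using (Car; ar)

Eq : (A : RSet) → Car A → Car A → Set
Eq A = RSet._≈_ A

disc : RankedSet → RSet
disc Σ' = record
  { Car = RankedSet.Car Σ'
  ; _≈_ = _≡_
  ; ar = RankedSet.ar Σ'
  ; ar-pos = RankedSet.ar-pos Σ'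
  ; ar-resp = cong (RankedSet.ar Σ') }

record Hom (A B : RSet) : Set where
  field
    fun     : Car A → Car B
    ar-pres : ∀ x → ar B (fun x) ≡ ar A x

open Hom public using (fun)

idH : (A : RSet) → Hom A A
idH A = record { fun = λ x → x ; ar-pres = λ _ → refl }

_∘H_ : {A B C : RSet} → Hom B C → Hom A B → Hom A C
g ∘H f = record
  { fun = λ x → fun g (fun f x)
  ; ar-pres = λ x → trans (Hom.ar-pres g (fun f x)) (Hom.ar-pres f x) }

-- Hypervertices are Fin size (size ≥ 1),
-- hypervertex v has arity (arity v); a corner v[i] is a pair (v , i)
-- with i : Fin (arity v) (0-based).  The edge relation is a Bool-valued
-- binary relation on corners; the port function maps corners to Fin n
-- (0-based port numbers).

Corners : (m : ℕ) → (Fin m → ℕ) → Set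
Corners m a = Σ (Fin m) (λ v → Fin (a v))

record Hyp (A : RSet) (n : ℕ) : Set where
  field
    n-pos    : 1 ≤ n
    size     : ℕ
    nonempty : 1 ≤ size
    arity    : Fin size → ℕ
    label    : Fin size → Car A
    label-ar : ∀ v → ar A (label v) ≡ arity v
    edge     : Corners size arity → Corners size arity → Bool
    port     : Corners size arity → Fin n

open Hyp public

cornerMap : {m m' : ℕ} {a : Fin m → ℕ} {a' : Fin m' → ℕ}
  (φ : Fin m → Fin m') → (∀ v → a' (φ v) ≡ a v) →
  Corners m a → Corners m' a'
cornerMap φ eq (v , i) = φ v , cast (sym (eq v)) i

record Iso {A : RSet} {n n' : ℕ} (G : Hyp A n) (G' : Hyp A n') : Set where
  field
    same-n  : n ≡ n'
    φ       : Fin (size G) ↔ Fin (size G')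
    ar-eq   : ∀ v → arity G' (Inverse.to φ v) ≡ arity G v
    lab-rel : ∀ v → Eq A (label G v) (label G' (Inverse.to φ v))
    port-eq : ∀ c → toℕ (port G' (cornerMap (Inverse.to φ) ar-eq c)) ≡ toℕ (port G c)
    edge-eq : ∀ c d → edge G' (cornerMap (Inverse.to φ) ar-eq c)
                              (cornerMap (Inverse.to φ) ar-eq d) ≡ edge G c d

V : RSet → RSet
V A = record
  { Car = Σ ℕ (Hyp A)
  ; _≈_ = λ x y → Iso (proj₂ x) (proj₂ y)
  ; ar = proj₁
  ; ar-pos = λ x → n-pos (proj₂ x)
  ; ar-resp = Iso.same-n }

relabel : {A B : RSet} → Hom A B → {n : ℕ} → Hyp A n → Hyp B n
relabel g G = record
  { n-pos = n-pos G
  ; size = size G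
  ; nonempty = nonempty G
  ; arity = arity G
  ; label = λ v → fun g (label G v)
  ; label-ar = λ v → trans (Hom.ar-pres g (label G v)) (label-ar G v)
  ; edge = edge G
  ; port = port G }

Vmap : {A B : RSet} → Hom A B → Hom (V A) (V B)
Vmap g = record { fun = λ x → proj₁ x , relabel g (proj₂ x) ; ar-pres = λ _ → refl }

unitHyp : (A : RSet) → (a : Car A) → Hyp A (ar A a)
unitHyp A a = record
  { n-pos = RSet.ar-pos A a
  ; size = 1
  ; nonempty = Data.Nat.s≤s Data.Nat.z≤n
  ; arity = λ _ → ar A a
  ; label = λ _ → a
  ; label-ar = λ _ → refl
  ; edge = λ _ _ → false
  ; port = proj₂ }

unitH : (A : RSet) → Hom A (V A)
unitH A = record { fun = λ a → ar A a , unitHyp A a ; ar-pres = λ _ → refl }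

∑ : (m : ℕ) → (Fin m → ℕ) → ℕ
∑ zero    f = 0
∑ (suc m) f = f zero + ∑ m (λ v → f (suc v))

decode : (m : ℕ) (f : Fin m → ℕ) → Fin (∑ m f) → Σ (Fin m) (λ v → Fin (f v))
decode (suc m) f x with splitAt (f zero) x
... | inj₁ i = zero , i
... | inj₂ j with decode m (λ v → f (suc v)) j
...   | v , w = suc v , w

∑-pos : (m : ℕ) (f : Fin m → ℕ) → 1 ≤ m → (∀ v → 1 ≤ f v) → 1 ≤ ∑ m f
∑-pos (suc m) f _ h = ≤-trans (h zero) (m≤m+n (f zero) _)

module Flatten {A : RSet} {n : ℕ} (G : Hyp (V A) n) where

  L : (v : Fin (size G)) → Hyp A (proj₁ (label G v))
  L v = proj₂ (label G v)

  m : ℕ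
  m = ∑ (size G) (λ v → size (L v))

  dec : Fin m → Σ (Fin (size G)) (λ v → Fin (size (L v)))
  dec = decode (size G) (λ v → size (L v))

  arF : Fin m → ℕ
  arF x = arity (L (proj₁ (dec x))) (proj₂ (dec x))

  labF : Fin m → Car A
  labF x = label (L (proj₁ (dec x))) (proj₂ (dec x))

  -- port number j of w[i] in the label of v, seen as a corner v[j] of G
  outer : (v : Fin (size G)) → Corners (size (L v)) (arity (L v)) → Corners (size G) (arity G)
  outer v c = v , cast (label-ar G v) (port (L v) c)

  inner : (v v' : Fin (size G)) →
          Corners (size (L v)) (arity (L v)) → Corners (size (L v')) (arity (L v')) → Bool
  inner v v' c c' with v ≟ v'
  ... | yes refl = edge (L v) c c'
  ... | no _     = false

  hyp : Hyp A n
  hyp = record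
    { n-pos = n-pos G
    ; size = m
    ; nonempty = ∑-pos (size G) (λ v → size (L v)) (nonempty G) (λ v → nonempty (L v))
    ; arity = arF
    ; label = labF
    ; label-ar = λ x → label-ar (L (proj₁ (dec x))) (proj₂ (dec x))
    ; edge = λ c c' →
        inner (proj₁ (dec (proj₁ c))) (proj₁ (dec (proj₁ c')))
              (proj₂ (dec (proj₁ c)) , proj₂ c) (proj₂ (dec (proj₁ c')) , proj₂ c')
        ∨ edge G (outer (proj₁ (dec (proj₁ c))) (proj₂ (dec (proj₁ c)) , proj₂ c))
                 (outer (proj₁ (dec (proj₁ c'))) (proj₂ (dec (proj₁ c')) , proj₂ c'))
    ; port = λ c → port G (outer (proj₁ (dec (proj₁ c))) (proj₂ (dec (proj₁ c)) , proj₂ c)) }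

flatten : {A : RSet} {n : ℕ} → Hyp (V A) n → Hyp A n
flatten G = Flatten.hyp G

flattenH : (A : RSet) → Hom (V (V A)) (V A)
flattenH A = record { fun = λ x → proj₁ x , flatten (proj₂ x) ; ar-pres = λ _ → refl }

RHom : RankedSet → RankedSet → Set
RHom Σ₁ Σ₂ = Hom (disc Σ₁) (disc Σ₂)

-- Each law is an isomorphism whose vertex bijection only rearranges nested
-- Σ-types of hypervertices of labels; along it arities, labels and ports agree
-- up to casts of indices.  The one real computation is the edge relation in
-- associativity: an edge of flatten (flatten G) comes from a label of a label,
-- from a label, or from G itself, and flatten (V flatten G) produces the same
-- three disjuncts, only bracketed differently.
module Submission where

open import Defs

open import Data.Bool using (Bool; false; _∨_)
open import Data.Bool.Properties using (∨-assoc; ∨-identityʳ)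
open import Data.Empty using (⊥-elim)
open import Data.Fin using (Fin; zero; suc; toℕ; cast; splitAt; join; _↑ˡ_; _↑ʳ_; _≟_)
open import Data.Fin.Properties using (toℕ-injective; toℕ-cast; cast-is-id; splitAt-↑ˡ; splitAt-↑ʳ; join-splitAt)
open import Data.Nat using (ℕ; zero; suc)
open import Data.Product using (Σ; _×_; _,_; proj₁; proj₂)
open import Data.Product.Algebra using (Σ-assoc-alt)
open import Data.Product.Function.Dependent.Propositional using (Σ-↔)
open import Data.Sum using (inj₁; inj₂)
open import Function.Bundles using (_↔_; Inverse; Injection; mk↔ₛ′)
open import Function.Construct.Identity using (↔-id)
open import Function.Properties.Inverse using (↔-sym; ↔-trans; ↔⇒↣)
open import Relation.Binary.Definitions using (Reflexive)
open import Relation.Binary.PropositionalEquality using (_≡_; _≢_; refl; sym; trans; cong; cong₂; subst; module ≡-Reasoning)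
open import Relation.Nullary using (yes; no)

open Inverse using (to)
open ≡-Reasoning

encode : (m : ℕ) (f : Fin m → ℕ) → Σ (Fin m) (λ v → Fin (f v)) → Fin (∑ m f)
encode (suc m) f (zero  , i) = i ↑ˡ ∑ m (λ v → f (suc v))
encode (suc m) f (suc v , i) = f zero ↑ʳ encode m (λ v → f (suc v)) (v , i)

decode-encode : ∀ m f p → decode m f (encode m f p) ≡ p
decode-encode (suc m) f (zero , i)
  rewrite splitAt-↑ˡ (f zero) i (∑ m (λ v → f (suc v))) = refl
decode-encode (suc m) f (suc v , i)
  rewrite splitAt-↑ʳ (f zero) (∑ m (λ v → f (suc v))) (encode m (λ v → f (suc v)) (v , i))
        | decode-encode m (λ v → f (suc v)) (v , i) = refl

encode-decode : ∀ m f x → encode m f (decode m f x) ≡ x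
encode-decode (suc m) f x with splitAt (f zero) x in eq
... | inj₁ i = trans (cong (join (f zero) _) (sym eq)) (join-splitAt (f zero) _ x)
... | inj₂ j with decode m (λ v → f (suc v)) j in eq′
...   | v , i = begin
  f zero ↑ʳ encode m _ (v , i)          ≡⟨ cong (λ p → f zero ↑ʳ encode m _ p) eq′ ⟨
  f zero ↑ʳ encode m _ (decode m _ j)   ≡⟨ cong (f zero ↑ʳ_) (encode-decode m _ j) ⟩
  join (f zero) _ (inj₂ j)              ≡⟨ cong (join (f zero) _) eq ⟨
  join (f zero) _ (splitAt (f zero) x)  ≡⟨ join-splitAt (f zero) _ x ⟩
  x                                     ∎

decode-↔ : (m : ℕ) (f : Fin m → ℕ) → Fin (∑ m f) ↔ Σ (Fin m) (λ v → Fin (f v))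
decode-↔ m f = mk↔ₛ′ (decode m f) (encode m f) (decode-encode m f) (encode-decode m f)

cong-corner : {I X : Set} {a : I → ℕ} (F : (q : I) → Fin (a q) → X)
  {q p : I} {i : Fin (a q)} {j : Fin (a p)} → q ≡ p → toℕ i ≡ toℕ j → F q i ≡ F p j
cong-corner F refl i≡j = cong (F _) (toℕ-injective i≡j)

cong-corner₂ : {I I' X : Set} {a : I → ℕ} {a' : I' → ℕ}
  (F : (q : I) → Fin (a q) → (q' : I') → Fin (a' q') → X)
  {q p : I} {i : Fin (a q)} {j : Fin (a p)} {q' p' : I'} {i' : Fin (a' q')} {j' : Fin (a' p')} →
  q ≡ p → toℕ i ≡ toℕ j → q' ≡ p' → toℕ i' ≡ toℕ j' → F q i q' i' ≡ F p j p' j'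
cong-corner₂ F refl i≡j refl i'≡j' = cong₂ (λ i i' → F _ i _ i') (toℕ-injective i≡j) (toℕ-injective i'≡j')

toℕ-cast-cast : ∀ {a b c} .(e : a ≡ b) .(e' : a ≡ c) (i : Fin a) → toℕ (cast e i) ≡ toℕ (cast e' i)
toℕ-cast-cast e e' i = trans (toℕ-cast e i) (sym (toℕ-cast e' i))

record Presentation (A : RSet) (n : ℕ) : Set₁ where
  field
    Vertex : Set
    arity  : Vertex → ℕ
    label  : Vertex → Car A
    port   : (v : Vertex) → Fin (arity v) → Fin n
    edge   : (v : Vertex) → Fin (arity v) → (v' : Vertex) → Fin (arity v') → Bool

presentation : {A : RSet} {n : ℕ} → Hyp A n → Presentation A n
presentation G = record
  { Vertex = Fin (size G)
  ; arity  = arity G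
  ; label  = label G
  ; port   = λ v i → port G (v , i)
  ; edge   = λ v i v' i' → edge G (v , i) (v' , i')
  }

-- The flattening of the paper, whose hypervertices are the pairs (v , w);
-- Defs.flatten is the same hypergraph with these pairs numbered by decode.
flattening : {A : RSet} {n : ℕ} → Hyp (V A) n → Presentation A n
flattening G = record
  { Vertex = Σ (Fin (size G)) (λ v → Fin (size (L v)))
  ; arity  = λ q → arity (L (proj₁ q)) (proj₂ q)
  ; label  = λ q → label (L (proj₁ q)) (proj₂ q)
  ; port   = λ q i → port G (outer (proj₁ q) (proj₂ q , i))
  ; edge   = λ q i q' i' → inner (proj₁ q) (proj₁ q') (proj₂ q , i) (proj₂ q' , i')
                           ∨ edge G (outer (proj₁ q) (proj₂ q , i)) (outer (proj₁ q') (proj₂ q' , i'))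
  }
  where open Flatten G

record _≅_ {A : RSet} {n n' : ℕ} (P : Presentation A n) (Q : Presentation A n') : Set where
  private
    module P = Presentation P
    module Q = Presentation Q
  field
    same-n  : n ≡ n'
    φ       : P.Vertex ↔ Q.Vertex
    ar-eq   : ∀ v → Q.arity (to φ v) ≡ P.arity v
    lab-rel : ∀ v → Eq A (P.label v) (Q.label (to φ v))
    port-eq : ∀ v i → toℕ (Q.port (to φ v) (cast (sym (ar-eq v)) i)) ≡ toℕ (P.port v i)
    edge-eq : ∀ v i v' i' →
      Q.edge (to φ v) (cast (sym (ar-eq v)) i) (to φ v') (cast (sym (ar-eq v')) i') ≡ P.edge v i v' i'

module _ {A : RSet} {n : ℕ} (G : Hyp (V A) n) where
  private
    module F = Presentation (flattening G)

    decode-encode-flatten : ∀ q → Flatten.dec G (encode _ _ q) ≡ q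
    decode-encode-flatten = decode-encode (size G) (λ v → size (Flatten.L G v))

  flatten-vertex : Presentation.Vertex (flattening G) → Fin (size (flatten G))
  flatten-vertex = encode (size G) (λ v → size (Flatten.L G v))

  arity-flatten-vertex : ∀ q → arity (flatten G) (flatten-vertex q) ≡ F.arity q
  arity-flatten-vertex q = cong F.arity (decode-encode-flatten q)

  label-flatten-vertex : ∀ q → label (flatten G) (flatten-vertex q) ≡ F.label q
  label-flatten-vertex q = cong F.label (decode-encode-flatten q)

  port-flatten-vertex : ∀ q {i j} → toℕ i ≡ toℕ j → port (flatten G) (flatten-vertex q , i) ≡ F.port q j
  port-flatten-vertex q = cong-corner F.port (decode-encode-flatten q)

  edge-flatten-vertex : ∀ q {i j} q' {i' j'} → toℕ i ≡ toℕ j → toℕ i' ≡ toℕ j' →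
    edge (flatten G) (flatten-vertex q , i) (flatten-vertex q' , i') ≡ F.edge q j q' j'
  edge-flatten-vertex q q' i≡j i'≡j' =
    cong-corner₂ F.edge (decode-encode-flatten q) i≡j (decode-encode-flatten q') i'≡j'

module _ {A : RSet} {n : ℕ} (G : Hyp (V A) n) where
  open Flatten G using (L; inner)

  inner-diag : ∀ v c c' → inner v v c c' ≡ edge (L v) c c'
  inner-diag v c c' with v ≟ v
  ... | yes refl = refl
  ... | no v≢v   = ⊥-elim (v≢v refl)

  inner-off : ∀ {v v'} → v ≢ v' → ∀ c c' → inner v v' c c' ≡ false
  inner-off {v} {v'} v≢v' c c' with v ≟ v'
  ... | yes v≡v' = ⊥-elim (v≢v' v≡v')
  ... | no _     = refl

module _ {A : RSet} {n n' : ℕ} {G : Hyp (V A) n} where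

  flatten-iso : {H : Hyp A n'} → flattening G ≅ presentation H → Iso (flatten G) H
  flatten-iso G≅H = record
    { same-n  = same-n
    ; φ       = ↔-trans (decode-↔ _ _) φ
    ; ar-eq   = λ x → ar-eq (dec x)
    ; lab-rel = λ x → lab-rel (dec x)
    ; port-eq = λ (x , i) → port-eq (dec x) i
    ; edge-eq = λ (x , i) (x' , i') → edge-eq (dec x) i (dec x') i'
    }
    where open _≅_ G≅H
          open Flatten G using (dec)

  ≅-flattenʳ : {G' : Hyp (V A) n'} → flattening G ≅ flattening G' → flattening G ≅ presentation (flatten G')
  ≅-flattenʳ {G'} G≅G' = record
    { same-n  = same-n
    ; φ       = ↔-trans φ (↔-sym (decode-↔ _ _))
    ; ar-eq   = λ q → trans (arity-flatten-vertex G' (to φ q)) (ar-eq q)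
    ; lab-rel = λ q → subst (Eq A _) (sym (label-flatten-vertex G' (to φ q))) (lab-rel q)
    ; port-eq = λ q i →
        trans (cong toℕ (port-flatten-vertex G' (to φ q) (toℕ-cast-cast _ _ i))) (port-eq q i)
    ; edge-eq = λ q i q' i' →
        trans (edge-flatten-vertex G' (to φ q) (to φ q') (toℕ-cast-cast _ _ i) (toℕ-cast-cast _ _ i'))
              (edge-eq q i q' i')
    }
    where open _≅_ G≅G'

  flatten-resp-≅ : {G' : Hyp (V A) n'} → flattening G ≅ flattening G' → Iso (flatten G) (flatten G')
  flatten-resp-≅ G≅G' = flatten-iso (≅-flattenʳ G≅G')

cornerMap-id : {m : ℕ} {a : Fin m → ℕ} (c : Corners m a) → cornerMap (λ v → v) (λ _ → refl) c ≡ c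
cornerMap-id (v , i) = cong (v ,_) (cast-is-id refl i)

-- label-ar is proof-relevant, so reflexivity has to allow replacing it.
Iso-refl : {A : RSet} {n : ℕ} → Reflexive (Eq A) →
  (G : Hyp A n) (la : ∀ v → ar A (label G v) ≡ arity G v) → Iso G (record G { label-ar = la })
Iso-refl r G la = record
  { same-n  = refl
  ; φ       = ↔-id _
  ; ar-eq   = λ _ → refl
  ; lab-rel = λ _ → r
  ; port-eq = λ c → cong (λ c → toℕ (port G c)) (cornerMap-id c)
  ; edge-eq = λ c c' → cong₂ (edge G) (cornerMap-id c) (cornerMap-id c')
  }

relabel-id : {A : RSet} {n : ℕ} → Reflexive (Eq A) → (G : Hyp A n) → Iso (relabel (idH A) G) G
relabel-id {A} r G = Iso-refl r (relabel (idH A) G) (label-ar G)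

relabel-∘ : {A B C : RSet} {n : ℕ} → Reflexive (Eq C) → (f : Hom A B) (g : Hom B C) (G : Hyp A n) →
  Iso (relabel (g ∘H f) G) (relabel g (relabel f G))
relabel-∘ r f g G = Iso-refl r (relabel (g ∘H f) G) (label-ar (relabel g (relabel f G)))

module _ {A B : RSet} (g : Hom A B) where

  relabel-resp-Iso : (∀ {x y} → Eq A x y → Eq B (fun g x) (fun g y)) →
    {n n' : ℕ} {G : Hyp A n} {G' : Hyp A n'} → Iso G G' → Iso (relabel g G) (relabel g G')
  relabel-resp-Iso g-resp I = record
    { same-n  = same-n
    ; φ       = φ
    ; ar-eq   = ar-eq
    ; lab-rel = λ v → g-resp (lab-rel v)
    ; port-eq = port-eq
    ; edge-eq = edge-eq
    }
    where open Iso I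

  relabel-unit : Reflexive (Eq B) → ∀ a → Iso (relabel g (unitHyp A a)) (unitHyp B (fun g a))
  relabel-unit r a = record
    { same-n  = sym (Hom.ar-pres g a)
    ; φ       = ↔-id _
    ; ar-eq   = λ _ → Hom.ar-pres g a
    ; lab-rel = λ _ → r
    ; port-eq = λ (_ , i) → toℕ-cast _ i
    ; edge-eq = λ _ _ → refl
    }

  inner-relabel : {n : ℕ} (G : Hyp (V A) n) → ∀ v v' c c' →
    Flatten.inner (relabel (Vmap g) G) v v' c c' ≡ Flatten.inner G v v' c c'
  inner-relabel G v v' c c' with v ≟ v'
  ... | yes refl = refl
  ... | no _     = refl

  relabel-flatten : Reflexive (Eq B) → {n : ℕ} (G : Hyp (V A) n) →
    Iso (relabel g (flatten G)) (flatten (relabel (Vmap g) G))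
  relabel-flatten r G = record
    { same-n  = refl
    ; φ       = ↔-id _
    ; ar-eq   = λ _ → refl
    ; lab-rel = λ _ → r
    ; port-eq = λ c → cong (λ c → toℕ (port (flatten G) c)) (cornerMap-id c)
    ; edge-eq = λ c c' → trans (cong₂ (edge (flatten (relabel (Vmap g) G))) (cornerMap-id c) (cornerMap-id c'))
                               (edge-relabel c c')
    }
    where
    edge-relabel : ∀ c c' → edge (flatten (relabel (Vmap g) G)) c c' ≡ edge (flatten G) c c'
    edge-relabel (x , i) (x' , i') =
      cong (_∨ edge G (outer (proj₁ (dec x)) (proj₂ (dec x) , i)) (outer (proj₁ (dec x')) (proj₂ (dec x') , i')))
           (inner-relabel G _ _ (proj₂ (dec x) , i) (proj₂ (dec x') , i'))
      where open Flatten G using (dec; outer)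

unitHyp-resp : (A : RSet) {a b : Car A} → Eq A a b → Iso (unitHyp A a) (unitHyp A b)
unitHyp-resp A a≈b = record
  { same-n  = RSet.ar-resp A a≈b
  ; φ       = ↔-id _
  ; ar-eq   = λ _ → sym (RSet.ar-resp A a≈b)
  ; lab-rel = λ _ → a≈b
  ; port-eq = λ (_ , i) → toℕ-cast _ i
  ; edge-eq = λ _ _ → refl
  }

module _ {A : RSet} {n n' : ℕ} {G : Hyp (V A) n} {G' : Hyp (V A) n'} (I : Iso G G') where
  private
    open Iso I
    module G  = Flatten G
    module G' = Flatten G'

    π : Fin (size G) → Fin (size G')
    π = to φ

    J : ∀ v → Iso (G.L v) (G'.L (π v))
    J = lab-rel

    mapᴶ : ∀ v → Corners (size (G.L v)) (arity (G.L v)) → Corners (size (G'.L (π v))) (arity (G'.L (π v)))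
    mapᴶ v = cornerMap (to (Iso.φ (J v))) (Iso.ar-eq (J v))

    mapᴵ : Corners (size G) (arity G) → Corners (size G') (arity G')
    mapᴵ = cornerMap π ar-eq

  outer-Iso : ∀ v c → G'.outer (π v) (mapᴶ v c) ≡ mapᴵ (G.outer v c)
  outer-Iso v c = cong (π v ,_) (toℕ-injective (begin
    toℕ (proj₂ (G'.outer (π v) (mapᴶ v c)))  ≡⟨ toℕ-cast _ _ ⟩
    toℕ (port (G'.L (π v)) (mapᴶ v c))       ≡⟨ Iso.port-eq (J v) c ⟩
    toℕ (port (G.L v) c)                    ≡⟨ toℕ-cast _ _ ⟨
    toℕ (proj₂ (G.outer v c))               ≡⟨ toℕ-cast _ _ ⟨
    toℕ (proj₂ (mapᴵ (G.outer v c)))        ∎))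

  inner-Iso : ∀ v v' c c' → G'.inner (π v) (π v') (mapᴶ v c) (mapᴶ v' c') ≡ G.inner v v' c c'
  inner-Iso v v' c c' with v ≟ v'
  inner-Iso v v' c c' | yes refl with π v ≟ π v
  ... | yes refl = Iso.edge-eq (J v) c c'
  ... | no πv≢πv = ⊥-elim (πv≢πv refl)
  inner-Iso v v' c c' | no v≢v' with π v ≟ π v'
  ... | yes πv≡πv' = ⊥-elim (v≢v' (Injection.injective (↔⇒↣ φ) πv≡πv'))
  ... | no _       = refl

  flattening-resp-Iso : flattening G ≅ flattening G'
  flattening-resp-Iso = record
    { same-n  = same-n
    ; φ       = Σ-↔ φ (λ {v} → Iso.φ (J v))
    ; ar-eq   = λ (v , w) → Iso.ar-eq (J v) w
    ; lab-rel = λ (v , w) → Iso.lab-rel (J v) w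
    ; port-eq = λ (v , w) i → trans (cong (λ c → toℕ (port G' c)) (outer-Iso v (w , i)))
                                    (port-eq (G.outer v (w , i)))
    ; edge-eq = λ (v , w) i (v' , w') i' →
        cong₂ _∨_ (inner-Iso v v' (w , i) (w' , i'))
                  (trans (cong₂ (edge G') (outer-Iso v (w , i)) (outer-Iso v' (w' , i')))
                         (edge-eq (G.outer v (w , i)) (G.outer v' (w' , i'))))
    }

  flatten-resp-Iso : Iso (flatten G) (flatten G')
  flatten-resp-Iso = flatten-resp-≅ flattening-resp-Iso

module _ {A : RSet} (r : Reflexive (Eq A)) {n : ℕ} (G : Hyp A n) where

  flattening-unit : flattening (unitHyp (V A) (n , G)) ≅ presentation G
  flattening-unit = record
    { same-n  = refl
    ; φ       = mk↔ₛ′ proj₂ (zero ,_) (λ _ → refl) (λ { (zero , _) → refl })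
    ; ar-eq   = λ _ → refl
    ; lab-rel = λ _ → r
    ; port-eq = λ { (zero , w) i → trans (cong (λ i → toℕ (port G (w , i))) (cast-is-id _ i))
                                         (sym (toℕ-cast _ (port G (w , i)))) }
    ; edge-eq = λ { (zero , w) i (zero , w') i' →
        trans (cong₂ (λ i i' → edge G (w , i) (w' , i')) (cast-is-id _ i) (cast-is-id _ i'))
              (sym (∨-identityʳ _)) }
    }

  flatten-unit : Iso (flatten (unitHyp (V A) (n , G))) G
  flatten-unit = flatten-iso flattening-unit

  inner-Vunit : ∀ v v' c c' → Flatten.inner (relabel (unitH A) G) v v' c c' ≡ false
  inner-Vunit v v' c c' with v ≟ v'
  ... | yes refl = refl
  ... | no _     = refl

  flattening-Vunit : flattening (relabel (unitH A) G) ≅ presentation G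
  flattening-Vunit = record
    { same-n  = refl
    ; φ       = mk↔ₛ′ proj₁ (_, zero) (λ _ → refl) (λ { (_ , zero) → refl })
    ; ar-eq   = λ (v , _) → sym (label-ar G v)
    ; lab-rel = λ _ → r
    ; port-eq = λ (v , _) i → cong (λ i → toℕ (port G (v , i))) (toℕ-injective (toℕ-cast-cast _ _ i))
    ; edge-eq = λ (v , w) i (v' , w') i' →
        trans (cong₂ (λ i i' → edge G (v , i) (v' , i')) (toℕ-injective (toℕ-cast-cast _ _ i))
                                                         (toℕ-injective (toℕ-cast-cast _ _ i')))
              (cong (_∨ edge G (v , cast (label-ar G v) i) (v' , cast (label-ar G v') i')) (sym (inner-Vunit v v' (w , i) (w' , i'))))
    }

  flatten-Vunit : Iso (flatten (relabel (unitH A) G)) G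
  flatten-Vunit = flatten-iso flattening-Vunit

module _ {A : RSet} (r : Reflexive (Eq A)) {n : ℕ} (G : Hyp (V (V A)) n) where
  private
    K  = flatten G
    G₂ = relabel (flattenH A) G
    module G  = Flatten G
    module G₂ = Flatten G₂
    module K  = Flatten K
    module L (v : Fin (size G)) = Flatten (G.L v)

    -- u[i] in the label of w in the label of v, as a corner of the flattened label of v
    corner₂ : ∀ v w u → Fin (arity (L.L v w) u) → Corners (size (G₂.L v)) (arity (G₂.L v))
    corner₂ v w u i = flatten-vertex (G.L v) (w , u) , cast (sym (arity-flatten-vertex (G.L v) (w , u))) i

  outer-assoc : ∀ v w u i → G₂.outer v (corner₂ v w u i) ≡ G.outer v (L.outer v w (u , i))
  outer-assoc v w u i = cong (v ,_) (toℕ-injective (begin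
    toℕ (proj₂ (G₂.outer v (corner₂ v w u i)))      ≡⟨ toℕ-cast _ _ ⟩
    toℕ (port (G₂.L v) (corner₂ v w u i))           ≡⟨ cong toℕ (port-flatten-vertex (G.L v) (w , u) (toℕ-cast _ i)) ⟩
    toℕ (port (G.L v) (L.outer v w (u , i)))        ≡⟨ toℕ-cast _ _ ⟨
    toℕ (proj₂ (G.outer v (L.outer v w (u , i))))   ∎))

  inner-assoc-same : ∀ v w u i u' i' →
    G₂.inner v v (corner₂ v w u i) (corner₂ v w u' i')
      ≡ edge (L.L v w) (u , i) (u' , i') ∨ G.inner v v (L.outer v w (u , i)) (L.outer v w (u' , i'))
  inner-assoc-same v w u i u' i' = begin
    G₂.inner v v (corner₂ v w u i) (corner₂ v w u' i')
      ≡⟨ inner-diag G₂ v _ _ ⟩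
    edge (G₂.L v) (corner₂ v w u i) (corner₂ v w u' i')
      ≡⟨ edge-flatten-vertex (G.L v) (w , u) (w , u') (toℕ-cast _ i) (toℕ-cast _ i') ⟩
    L.inner v w w (u , i) (u' , i') ∨ edge (G.L v) (L.outer v w (u , i)) (L.outer v w (u' , i'))
      ≡⟨ cong (_∨ edge (G.L v) (L.outer v w (u , i)) (L.outer v w (u' , i'))) (inner-diag (G.L v) w _ _) ⟩
    edge (L.L v w) (u , i) (u' , i') ∨ edge (G.L v) (L.outer v w (u , i)) (L.outer v w (u' , i'))
      ≡⟨ cong (edge (L.L v w) (u , i) (u' , i') ∨_) (inner-diag G v _ _) ⟨
    edge (L.L v w) (u , i) (u' , i') ∨ G.inner v v (L.outer v w (u , i)) (L.outer v w (u' , i'))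
      ∎

  inner-assoc-distinct : ∀ v w v' w' → (v , w) ≢ (v' , w') → ∀ u i u' i' →
    G₂.inner v v' (corner₂ v w u i) (corner₂ v' w' u' i')
      ≡ G.inner v v' (L.outer v w (u , i)) (L.outer v' w' (u' , i'))
  inner-assoc-distinct v w v' w' q≢q' u i u' i' with v ≟ v'
  ... | no _     = refl
  ... | yes refl = trans (edge-flatten-vertex (G.L v) (w , u) (w' , u') (toℕ-cast _ i) (toℕ-cast _ i'))
                         (cong (_∨ edge (G.L v) (L.outer v w (u , i)) (L.outer v w' (u' , i')))
                               (inner-off (G.L v) (λ w≡w' → q≢q' (cong (v ,_) w≡w')) _ _))

  inner-assoc : ∀ p u i p' u' i' → let (v , w) = G.dec p; (v' , w') = G.dec p' in
    G₂.inner v v' (corner₂ v w u i) (corner₂ v' w' u' i')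
      ≡ K.inner p p' (u , i) (u' , i') ∨ G.inner v v' (L.outer v w (u , i)) (L.outer v' w' (u' , i'))
  inner-assoc p u i p' u' i' with p ≟ p'
  ... | yes refl = inner-assoc-same (proj₁ (G.dec p)) (proj₂ (G.dec p)) u i u' i'
  ... | no p≢p'  = inner-assoc-distinct _ _ _ _ (λ q≡q' → p≢p' (Injection.injective (↔⇒↣ (decode-↔ _ _)) q≡q'))
                                        u i u' i'

  edge-assoc : ∀ p u i p' u' i' → let (v , w) = G.dec p; (v' , w') = G.dec p' in
    G₂.inner v v' (corner₂ v w u i) (corner₂ v' w' u' i')
      ∨ edge G (G₂.outer v (corner₂ v w u i)) (G₂.outer v' (corner₂ v' w' u' i'))
      ≡ K.inner p p' (u , i) (u' , i') ∨ edge K (K.outer p (u , i)) (K.outer p' (u' , i'))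
  edge-assoc p u i p' u' i' =
    trans (cong₂ _∨_ (inner-assoc p u i p' u' i') (cong₂ (edge G) (outer-assoc v w u i) (outer-assoc v' w' u' i')))
          (∨-assoc (K.inner p p' (u , i) (u' , i')) (G.inner v v' c c') (edge G (G.outer v c) (G.outer v' c')))
    where
    v  = proj₁ (G.dec p)
    w  = proj₂ (G.dec p)
    v' = proj₁ (G.dec p')
    w' = proj₂ (G.dec p')
    c  = L.outer v w (u , i)
    c' = L.outer v' w' (u' , i')

  flattening-assoc : flattening K ≅ flattening G₂
  flattening-assoc = record
    { same-n  = refl
    ; φ       = ↔-trans (Σ-↔ (decode-↔ _ _) (↔-id _)) (↔-trans Σ-assoc-alt (Σ-↔ (↔-id _) (↔-sym (decode-↔ _ _))))
    ; ar-eq   = λ (p , u) → arity-flatten-vertex (G.L (proj₁ (G.dec p))) (proj₂ (G.dec p) , u)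
    ; lab-rel = λ (p , u) → subst (Eq A _) (sym (label-flatten-vertex (G.L (proj₁ (G.dec p))) (proj₂ (G.dec p) , u))) r
    ; port-eq = λ (p , u) i → cong (λ c → toℕ (port G c)) (outer-assoc (proj₁ (G.dec p)) (proj₂ (G.dec p)) u i)
    ; edge-eq = λ (p , u) i (p' , u') i' → edge-assoc p u i p' u' i'
    }

  flatten-assoc : Iso (flatten (flatten G)) (flatten (relabel (flattenH A) G))
  flatten-assoc = flatten-resp-≅ flattening-assoc

fact5p4 :
  -- well-definedness on isomorphism classes
  (∀ (A B : RSet) (g : Hom A B) → (∀ x y → Eq A x y → Eq B (fun g x) (fun g y)) →
     ∀ x y → Eq (V A) x y → Eq (V B) (fun (Vmap g) x) (fun (Vmap g) y))
  × (∀ (A : RSet) x y → Eq A x y → Eq (V A) (fun (unitH A) x) (fun (unitH A) y))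
  × (∀ (A : RSet) x y → Eq (V (V A)) x y → Eq (V A) (fun (flattenH A) x) (fun (flattenH A) y))
  -- V is a functor
  × (∀ (S : RankedSet) x → Eq (V (disc S)) (fun (Vmap (idH (disc S))) x) x)
  × (∀ (S₁ S₂ S₃ : RankedSet) (f : RHom S₁ S₂) (g : RHom S₂ S₃) x →
       Eq (V (disc S₃)) (fun (Vmap (g ∘H f)) x) (fun (Vmap g) (fun (Vmap f) x)))
  -- naturality of unit and flattening
  × (∀ (S₁ S₂ : RankedSet) (f : RHom S₁ S₂) a →
       Eq (V (disc S₂)) (fun (Vmap f) (fun (unitH (disc S₁)) a)) (fun (unitH (disc S₂)) (fun f a)))
  × (∀ (S₁ S₂ : RankedSet) (f : RHom S₁ S₂) x →
       Eq (V (disc S₂)) (fun (Vmap f) (fun (flattenH (disc S₁)) x))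
                        (fun (flattenH (disc S₂)) (fun (Vmap (Vmap f)) x)))
  -- associativity
  × (∀ (S : RankedSet) x →
       Eq (V (disc S)) (fun (flattenH (disc S)) (fun (flattenH (V (disc S))) x))
                       (fun (flattenH (disc S)) (fun (Vmap (flattenH (disc S))) x)))
  -- unit laws
  × (∀ (S : RankedSet) x →
       Eq (V (disc S)) (fun (flattenH (disc S)) (fun (unitH (V (disc S))) x)) x)
  × (∀ (S : RankedSet) x →
       Eq (V (disc S)) (fun (flattenH (disc S)) (fun (Vmap (unitH (disc S))) x)) x)
fact5p4 =
    (λ A B g g-resp _ _ I → relabel-resp-Iso g (g-resp _ _) I)
  , (λ A _ _ a≈b → unitHyp-resp A a≈b)
  , (λ A _ _ I → flatten-resp-Iso I)
  , (λ S (_ , G) → relabel-id refl G)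
  , (λ S₁ S₂ S₃ f g (_ , G) → relabel-∘ refl f g G)
  , (λ S₁ S₂ f a → relabel-unit f refl a)
  , (λ S₁ S₂ f (_ , G) → relabel-flatten f refl G)
  , (λ S (_ , G) → flatten-assoc refl G)
  , (λ S (_ , G) → flatten-unit refl G)
  , (λ S (_ , G) → flatten-Vunit refl G)
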